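{- Let $G,H$ be finite alphabets, $S\subseteq G^n$, and $f:S\to H$ a non-constant partial function. Then $$\mathrm{CA}_1(f)=\max_{A,B,p,q}\ \min_{\substack{i\in[n],\ g_1,g_2\in G,\ g_1\neq g_2:\\ \exists x\in X,\,y\in Y:\ x_i=g_1,\ y_i=g_2,\ p(x)q(y)>0}}\ \frac{1}{\min\{\Pr_{y\sim q}[y_i\neq g_1],\ \Pr_{x\sim p}[x_i\neq g_2]\}},$$ where the maximum ranges over all partitions $H=A\cup B$ with $A\cap B=\varnothing$, writing $X=f^{ -1}(A)$, $Y=f^{ -1}(B)$, and over all probability distributions $p$ on $X$ and $q$ on $Y$.
   Context: For $x\in S$, $x_i$ is its $i$-th letter. Rank-1 relational adversary bound: take functions $u,v:S\to\mathbb{R}_{\ge0}$ with $u(x)v(y)=0$ whenever $f(x)=f(y)$, not both giving an identically zero product. Let $X=\{x: u(x)>0\}$ and $Y=\{y: v(y)>0\}$ (these are disjoint). For $x\in X$, $y\in Y$, $i\in[n]$ define $\theta(x,i)=\frac{\sum_{y'\in Y}v(y')}{\sum_{y'\in Y:\,x_i\neq y'_i}v(y')}$ and $\theta(y,i)=\frac{\sum_{x'\in X}u(x')}{\sum_{x'\in X:\,x'_i\neq y_i}u(x')}$. Then $\mathrm{CA}_1(f)=\max_{u,v}\min\{\max\{\theta(x,i),\theta(y,i)\}: x\in X,\ y\in Y,\ i\in[n],\ u(x)v(y)>0,\ x_i\neq y_i\}$.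
   Formalization: The weights $u,v$ and the probability distributions $p$ and $q$ take rational values instead of real ones. -}

module Defs where

open import Data.Nat using (ℕ; zero; suc)
open import Data.Fin using (Fin)
import Data.Fin.Properties as FinP
open import Data.Vec using (Vec; []; _∷_; lookup)
open import Data.List using (List; []; _∷_; [_]; map; concatMap; allFin; foldr)
open import Data.Maybe using (Maybe; just; nothing; Is-just)
open import Data.Bool using (Bool; true; false; if_then_else_)
open import Data.Product using (Σ; _×_; _,_; ∃)
open import Data.Rational using (ℚ; 0ℚ; 1ℚ; _+_; _*_; _≤_; _<_; _⊓_; _⊔_; 1/_; ≢-nonZero)
open import Data.Rational.Properties using (_≟_)
open import Relation.Nullary using (yes; no; does; ¬_)
open import Relation.Binary.PropositionalEquality using (_≡_; _≢_)

Word : ℕ → ℕ → Set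
Word k n = Vec (Fin k) n

allWords : (k n : ℕ) → List (Word k n)
allWords k zero    = [ [] ]
allWords k (suc n) = concatMap (λ a → map (a ∷_) (allWords k n)) (allFin k)

sumW : {k n : ℕ} → (Word k n → ℚ) → ℚ
sumW {k} {n} g = foldr (λ x acc → g x + acc) 0ℚ (allWords k n)

sumDiff : {k n : ℕ} → Fin n → Fin k → (Word k n → ℚ) → ℚ
sumDiff i a g = sumW (λ y → if does (lookup y i FinP.≟ a) then 0ℚ else g y)

-- Total reciprocal (1/0 := 0); only ever applied to positive numbers in
-- the feasible situations of the theorem.
recip : ℚ → ℚ
recip p with p ≟ 0ℚ
... | yes _  = 0ℚ
... | no p≢0 = 1/_ p {{≢-nonZero p≢0}}

IsMinOf : {I : Set} → (I → Set) → (I → ℚ) → ℚ → Set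
IsMinOf {I} P g t = (Σ I λ z → P z × g z ≡ t) × (∀ z → P z → t ≤ g z)

-- A partial function f : S → H with S ⊆ G^n is encoded as
-- f : G^n → Maybe H, where S = { x | f x ≢ nothing }.
module _ {k m n : ℕ} (f : Word k n → Maybe (Fin m)) where

  InS : Word k n → Set
  InS x = Is-just (f x)

  NonConstant : Set
  NonConstant = Σ (Word k n) λ x → Σ (Word k n) λ y →
                  InS x × InS y × f x ≢ f y

  -- Rank-1 relational adversary bound CA₁(f).
  -- u, v : S → ℝ≥0 are encoded as functions on G^n vanishing outside S.

  Admissible₁ : (u v : Word k n → ℚ) → Set
  Admissible₁ u v =
      (∀ x → 0ℚ ≤ u x) × (∀ y → 0ℚ ≤ v y)
    × (∀ x → 0ℚ < u x → InS x) × (∀ y → 0ℚ < v y → InS y)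
    × (∀ x y → InS x → InS y → f x ≡ f y → u x * v y ≡ 0ℚ)
    × (Σ (Word k n) λ x → Σ (Word k n) λ y → u x * v y ≢ 0ℚ)

  θX : (v : Word k n → ℚ) → Word k n → Fin n → ℚ
  θX v x i = sumW v * recip (sumDiff i (lookup x i) v)

  θY : (u : Word k n → ℚ) → Word k n → Fin n → ℚ
  θY u y i = sumW u * recip (sumDiff i (lookup y i) u)

  Triple : Set
  Triple = Word k n × Word k n × Fin n

  ActiveTriple₁ : (u v : Word k n → ℚ) → Triple → Set
  ActiveTriple₁ u v (x , y , i) = 0ℚ < u x * v y × lookup x i ≢ lookup y i

  objective₁ : (u v : Word k n → ℚ) → Triple → ℚ
  objective₁ u v (x , y , i) = θX v x i ⊔ θY u y i

  Value₁ : (u v : Word k n → ℚ) → ℚ → Set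
  Value₁ u v = IsMinOf (ActiveTriple₁ u v) (objective₁ u v)

  -- Right-hand side: partition H = A ∪ B (A given by its indicator,
  -- B its complement), X = f⁻¹(A), Y = f⁻¹(B), p, q distributions on X, Y.

  InPart : (A : Fin m → Bool) → Bool → Word k n → Set
  InPart A b x = Σ (Fin m) λ h → f x ≡ just h × A h ≡ b

  IsDistOn : (Word k n → Set) → (Word k n → ℚ) → Set
  IsDistOn Z p = (∀ x → 0ℚ ≤ p x) × (∀ x → 0ℚ < p x → Z x) × sumW p ≡ 1ℚ

  Admissible₂ : (A : Fin m → Bool) (p q : Word k n → ℚ) → Set
  Admissible₂ A p q = IsDistOn (InPart A true) p × IsDistOn (InPart A false) q

  Index : Set
  Index = Fin n × Fin k × Fin k

  ActiveIndex₂ : (A : Fin m → Bool) (p q : Word k n → ℚ) → Index → Set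
  ActiveIndex₂ A p q (i , g₁ , g₂) =
      g₁ ≢ g₂
    × (Σ (Word k n) λ x → Σ (Word k n) λ y →
         InPart A true x × InPart A false y
       × lookup x i ≡ g₁ × lookup y i ≡ g₂ × 0ℚ < p x * q y)

  objective₂ : (p q : Word k n → ℚ) → Index → ℚ
  objective₂ p q (i , g₁ , g₂) = recip (sumDiff i g₁ q ⊓ sumDiff i g₂ p)

  Value₂ : (A : Fin m → Bool) (p q : Word k n → ℚ) → ℚ → Set
  Value₂ A p q = IsMinOf (ActiveIndex₂ A p q) (objective₂ p q)

{-# OPTIONS --safe #-}

-- Both sides are the same minimum, written in two coordinate systems.
-- Scaling u and v by positive constants changes no θ, so (u, v) may be
-- normalised to probability distributions p, q; then θ(x,i) = 1 / Pr_q[y_i ≠ x_i],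
-- and on an active triple both probabilities are positive, so the larger
-- reciprocal is the reciprocal of the smaller probability.  The constraint
-- u(x)v(y) = 0 whenever f(x) = f(y) says precisely that A := f(supp u)
-- separates the two supports, and (x, y, i) ↦ (i, x_i, y_i) maps the active
-- triples onto the active indices, so the two minima coincide.
module Submission where

open import Defs
open import Data.Nat using (ℕ; zero; suc)
open import Data.Fin using (Fin)
import Data.Fin.Properties as FinP
open import Data.Vec using ([]; _∷_; lookup)
open import Data.List using (List; []; _∷_; map; foldr)
import Data.List.Relation.Unary.Any as Any
open import Data.List.Relation.Unary.Any using (here; there)
open import Data.List.Membership.Propositional using (_∈_; lose)
open import Data.List.Membership.Propositional.Properties using (∈-map⁺; ∈-concatMap⁺; ∈-allFin)
open import Data.Maybe using (Maybe; just; Is-just)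
open import Data.Maybe.Properties using (just-injective; ≡-dec)
import Data.Maybe.Relation.Unary.Any as MaybeAny
open import Data.Bool using (Bool; true; false; if_then_else_)
open import Data.Unit using (tt)
open import Data.Rational
  using (ℚ; 0ℚ; 1ℚ; _+_; _*_; _≤_; _<_; _⊓_; _⊔_; ≢-nonZero; positive; nonNegative)
open import Data.Rational.Properties
  using ( _≟_; _<?_; ≤-refl; <⇒≤; <⇒≢; ≮⇒≥; <-irrefl; <-cmp; <-≤-trans; ≤-total; module ≤-Reasoning
        ; positive⁻¹; nonNegative⁻¹; pos*pos⇒pos; nonNeg*nonNeg⇒nonNeg; 1/pos⇒pos; 1≢0
        ; +-identityˡ; +-identityʳ; +-mono-≤; +-monoˡ-≤; +-monoʳ-≤
        ; *-assoc; *-comm; *-identityˡ; *-identityʳ; *-zeroˡ; *-zeroʳ; *-distribˡ-+; *-inverseʳ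
        ; *-monoˡ-≤-nonNeg; *-monoʳ-≤-nonNeg; *-1-commutativeMonoid
        ; p≤q⇒p⊓q≡p; p≥q⇒p⊓q≡q; p≤q⇒p⊔q≡q; p≥q⇒p⊔q≡p )
open import Data.Product using (Σ; _×_; _,_)
open import Data.Sum using (inj₁; inj₂)
open import Data.Empty using (⊥-elim)
open import Function using (id)
open import Relation.Nullary using (Dec; yes; no; does; ¬_)
open import Relation.Nullary.Decidable using (_×-dec_; decidable-stable)
open import Relation.Binary.Definitions using (tri<; tri≈; tri>)
open import Relation.Binary.PropositionalEquality
open import Algebra.Bundles using (CommutativeMonoid)
open import Algebra.Properties.CommutativeSemigroup
  (CommutativeMonoid.commutativeSemigroup *-1-commutativeMonoid) using (interchange)

0<⇒≢0 : ∀ {p} → 0ℚ < p → p ≢ 0ℚ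
0<⇒≢0 0<p = ≢-sym (<⇒≢ 0<p)

0≤∧≢0⇒0< : ∀ {p} → 0ℚ ≤ p → p ≢ 0ℚ → 0ℚ < p
0≤∧≢0⇒0< {p} 0≤p p≢0 with <-cmp 0ℚ p
... | tri< 0<p _ _ = 0<p
... | tri≈ _ 0≡p _ = ⊥-elim (p≢0 (sym 0≡p))
... | tri> _ _ p<0 = ⊥-elim (<-irrefl refl (<-≤-trans p<0 0≤p))

pos*pos>0 : ∀ {p q} → 0ℚ < p → 0ℚ < q → 0ℚ < p * q
pos*pos>0 {p} {q} 0<p 0<q =
  positive⁻¹ (p * q) {{pos*pos⇒pos p {{positive 0<p}} q {{positive 0<q}}}}

nonNeg*nonNeg≥0 : ∀ {p q} → 0ℚ ≤ p → 0ℚ ≤ q → 0ℚ ≤ p * q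
nonNeg*nonNeg≥0 {p} {q} 0≤p 0≤q =
  nonNegative⁻¹ (p * q) {{nonNeg*nonNeg⇒nonNeg p {{nonNegative 0≤p}} q {{nonNegative 0≤q}}}}

*-pos⇒posˡ : ∀ {p q} → 0ℚ ≤ p → 0ℚ < p * q → 0ℚ < p
*-pos⇒posˡ {p} {q} 0≤p 0<pq =
  0≤∧≢0⇒0< 0≤p λ p≡0 → 0<⇒≢0 0<pq (trans (cong (_* q) p≡0) (*-zeroˡ q))

*-pos⇒posʳ : ∀ {p q} → 0ℚ ≤ q → 0ℚ < p * q → 0ℚ < q
*-pos⇒posʳ {p} {q} 0≤q 0<pq = *-pos⇒posˡ 0≤q (subst (0ℚ <_) (*-comm p q) 0<pq)

*-nonNeg-≡0 : ∀ {p q} → 0ℚ ≤ p → 0ℚ ≤ q → ¬ (0ℚ < p × 0ℚ < q) → p * q ≡ 0ℚ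
*-nonNeg-≡0 {p} {q} 0≤p 0≤q ¬both = decidable-stable (p * q ≟ 0ℚ) λ pq≢0 →
  let 0<pq = 0≤∧≢0⇒0< (nonNeg*nonNeg≥0 0≤p 0≤q) pq≢0
  in ¬both (*-pos⇒posˡ {q = q} 0≤p 0<pq , *-pos⇒posʳ {p} 0≤q 0<pq)

*-recip : ∀ {p} → p ≢ 0ℚ → p * recip p ≡ 1ℚ
*-recip {p} p≢0 with p ≟ 0ℚ
... | yes p≡0  = ⊥-elim (p≢0 p≡0)
... | no  p≢0′ = *-inverseʳ p {{≢-nonZero p≢0′}}

recip-unique : ∀ p q → p * q ≡ 1ℚ → recip p ≡ q
recip-unique p q pq≡1 = begin
  recip p            ≡⟨ *-identityʳ (recip p) ⟨
  recip p * 1ℚ       ≡⟨ cong (recip p *_) pq≡1 ⟨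
  recip p * (p * q)  ≡⟨ *-assoc (recip p) p q ⟨
  recip p * p * q    ≡⟨ cong (_* q) (trans (*-comm (recip p) p) (*-recip p≢0)) ⟩
  1ℚ * q             ≡⟨ *-identityˡ q ⟩
  q                  ∎
  where
  open ≡-Reasoning
  p≢0 : p ≢ 0ℚ
  p≢0 p≡0 = 1≢0 (trans (sym pq≡1) (trans (cong (_* q) p≡0) (*-zeroˡ q)))

-- Multiplicativity holds even through the junk value recip 0ℚ = 0ℚ.
recip-* : ∀ p q → recip (p * q) ≡ recip p * recip q
recip-* p q = by-cases (p ≟ 0ℚ) (q ≟ 0ℚ)
  where
  open ≡-Reasoning
  -- A `with` on p ≟ 0ℚ would also abstract the same test inside recip p.
  by-cases : Dec (p ≡ 0ℚ) → Dec (q ≡ 0ℚ) → recip (p * q) ≡ recip p * recip q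
  by-cases (yes p≡0) _ = begin
    recip (p * q)        ≡⟨ cong (λ r → recip (r * q)) p≡0 ⟩
    recip (0ℚ * q)       ≡⟨ cong recip (*-zeroˡ q) ⟩
    0ℚ                   ≡⟨ *-zeroˡ (recip q) ⟨
    recip 0ℚ * recip q   ≡⟨ cong (λ r → recip r * recip q) p≡0 ⟨
    recip p * recip q    ∎
  by-cases _ (yes q≡0) = begin
    recip (p * q)        ≡⟨ cong (λ r → recip (p * r)) q≡0 ⟩
    recip (p * 0ℚ)       ≡⟨ cong recip (*-zeroʳ p) ⟩
    0ℚ                   ≡⟨ *-zeroʳ (recip p) ⟨
    recip p * recip 0ℚ   ≡⟨ cong (λ r → recip p * recip r) q≡0 ⟨
    recip p * recip q    ∎
  by-cases (no p≢0) (no q≢0) = recip-unique (p * q) (recip p * recip q) (begin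
    p * q * (recip p * recip q)   ≡⟨ interchange p q (recip p) (recip q) ⟩
    p * recip p * (q * recip q)   ≡⟨ cong₂ _*_ (*-recip p≢0) (*-recip q≢0) ⟩
    1ℚ                            ∎)

recip-pos : ∀ {p} → 0ℚ < p → 0ℚ < recip p
recip-pos {p} 0<p with p ≟ 0ℚ
... | yes p≡0 = ⊥-elim (0<⇒≢0 0<p p≡0)
... | no  p≢0 = positive⁻¹ _ {{1/pos⇒pos p {{positive 0<p}}}}

recip-antimono : ∀ {p q} → 0ℚ < p → p ≤ q → recip q ≤ recip p
recip-antimono {p} {q} 0<p p≤q = begin
  recip q                      ≡⟨ *-identityʳ (recip q) ⟨
  recip q * 1ℚ                 ≡⟨ cong (recip q *_) (*-recip (0<⇒≢0 0<p)) ⟨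
  recip q * (p * recip p)      ≡⟨ *-assoc (recip q) p (recip p) ⟨
  recip q * p * recip p        ≤⟨ *-monoʳ-≤-nonNeg (recip p) {{nonNegative (<⇒≤ (recip-pos 0<p))}}
                                    (*-monoˡ-≤-nonNeg (recip q) {{nonNegative (<⇒≤ (recip-pos 0<q))}} p≤q) ⟩
  recip q * q * recip p        ≡⟨ cong (_* recip p) (trans (*-comm (recip q) q) (*-recip (0<⇒≢0 0<q))) ⟩
  1ℚ * recip p                 ≡⟨ *-identityˡ (recip p) ⟩
  recip p                      ∎
  where
  open ≤-Reasoning
  0<q = <-≤-trans 0<p p≤q

recip-⊓ : ∀ {p q} → 0ℚ < p → 0ℚ < q → recip (p ⊓ q) ≡ recip p ⊔ recip q
recip-⊓ {p} {q} 0<p 0<q with ≤-total p q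
... | inj₁ p≤q = trans (cong recip (p≤q⇒p⊓q≡p p≤q)) (sym (p≥q⇒p⊔q≡p (recip-antimono 0<p p≤q)))
... | inj₂ q≤p = trans (cong recip (p≥q⇒p⊓q≡q q≤p)) (sym (p≤q⇒p⊔q≡q (recip-antimono 0<q q≤p)))

module _ {A : Set} where

  sumOver : List A → (A → ℚ) → ℚ
  sumOver xs g = foldr (λ x acc → g x + acc) 0ℚ xs

  sumOver-cong : ∀ xs {g h : A → ℚ} → (∀ x → g x ≡ h x) → sumOver xs g ≡ sumOver xs h
  sumOver-cong []       g≗h = refl
  sumOver-cong (x ∷ xs) g≗h = cong₂ _+_ (g≗h x) (sumOver-cong xs g≗h)

  sumOver-scale : ∀ xs c (g : A → ℚ) → sumOver xs (λ x → c * g x) ≡ c * sumOver xs g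
  sumOver-scale []       c g = sym (*-zeroʳ c)
  sumOver-scale (x ∷ xs) c g =
    trans (cong (c * g x +_) (sumOver-scale xs c g)) (sym (*-distribˡ-+ c (g x) (sumOver xs g)))

  sumOver-nonNeg : ∀ xs {g : A → ℚ} → (∀ x → 0ℚ ≤ g x) → 0ℚ ≤ sumOver xs g
  sumOver-nonNeg []       g≥0 = ≤-refl
  sumOver-nonNeg (x ∷ xs) g≥0 = +-mono-≤ (g≥0 x) (sumOver-nonNeg xs g≥0)

  ≤-sumOver : ∀ {xs} {g : A → ℚ} → (∀ x → 0ℚ ≤ g x) → ∀ {y} → y ∈ xs → g y ≤ sumOver xs g
  ≤-sumOver {x ∷ xs} {g} g≥0 (here refl) =
    subst (_≤ g x + sumOver xs g) (+-identityʳ (g x)) (+-monoʳ-≤ (g x) (sumOver-nonNeg xs g≥0))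
  ≤-sumOver {x ∷ xs} {g} g≥0 (there y∈xs) =
    subst (_≤ g x + sumOver xs g) (+-identityˡ (g _)) (+-mono-≤ (g≥0 x) (≤-sumOver g≥0 y∈xs))

  sumOver-pos⇒∃pos : ∀ xs (g : A → ℚ) → 0ℚ < sumOver xs g → Σ A λ x → 0ℚ < g x
  sumOver-pos⇒∃pos []       g 0<0 = ⊥-elim (<-irrefl refl 0<0)
  sumOver-pos⇒∃pos (x ∷ xs) g 0<Σ with 0ℚ <? g x
  ... | yes 0<gx = x , 0<gx
  ... | no  0≮gx = sumOver-pos⇒∃pos xs g (<-≤-trans 0<Σ gx+Σ≤Σ)
    where
    gx+Σ≤Σ : g x + sumOver xs g ≤ sumOver xs g
    gx+Σ≤Σ = subst (g x + sumOver xs g ≤_) (+-identityˡ _) (+-monoˡ-≤ (sumOver xs g) (≮⇒≥ 0≮gx))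

∈-allWords : ∀ k n (x : Word k n) → x ∈ allWords k n
∈-allWords k zero    []      = here refl
∈-allWords k (suc n) (a ∷ x) =
  ∈-concatMap⁺ (λ b → map (b ∷_) (allWords k n))
               (Any.map (λ { refl → ∈-map⁺ (a ∷_) (∈-allWords k n x) }) (∈-allFin a))

Is-just⇒≡just : ∀ {A : Set} {mx : Maybe A} → Is-just mx → Σ A λ a → mx ≡ just a
Is-just⇒≡just (MaybeAny.just {x = a} _) = a , refl

≡just⇒Is-just : ∀ {A : Set} {mx : Maybe A} {a : A} → mx ≡ just a → Is-just mx
≡just⇒Is-just refl = MaybeAny.just tt

module _ {k n : ℕ} where

  infixr 7 _·_

  _·_ : ℚ → (Word k n → ℚ) → Word k n → ℚ
  (c · g) x = c * g x

  normalize : (Word k n → ℚ) → Word k n → ℚ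
  normalize g = recip (sumW g) · g

  sumW-scale : ∀ c (g : Word k n → ℚ) → sumW (c · g) ≡ c * sumW g
  sumW-scale = sumOver-scale (allWords k n)

  ≤-sumW : ∀ {g : Word k n → ℚ} → (∀ x → 0ℚ ≤ g x) → ∀ y → g y ≤ sumW g
  ≤-sumW g≥0 y = ≤-sumOver g≥0 (∈-allWords k n y)

  sumW-pos⇒∃pos : ∀ (g : Word k n → ℚ) → 0ℚ < sumW g → Σ (Word k n) λ x → 0ℚ < g x
  sumW-pos⇒∃pos = sumOver-pos⇒∃pos (allWords k n)

  restrict≢ : Fin n → Fin k → (Word k n → ℚ) → Word k n → ℚ
  restrict≢ i a g y = if does (lookup y i FinP.≟ a) then 0ℚ else g y

  restrict≢-scale : ∀ i a c (g : Word k n → ℚ) y → restrict≢ i a (c · g) y ≡ c * restrict≢ i a g y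
  restrict≢-scale i a c g y with lookup y i FinP.≟ a
  ... | yes _ = sym (*-zeroʳ c)
  ... | no  _ = refl

  restrict≢-nonNeg : ∀ i a {g : Word k n → ℚ} → (∀ x → 0ℚ ≤ g x) → ∀ y → 0ℚ ≤ restrict≢ i a g y
  restrict≢-nonNeg i a g≥0 y with lookup y i FinP.≟ a
  ... | yes _ = ≤-refl
  ... | no  _ = g≥0 y

  restrict≢-≢ : ∀ i a (g : Word k n → ℚ) {y} → lookup y i ≢ a → restrict≢ i a g y ≡ g y
  restrict≢-≢ i a g {y} yᵢ≢a with lookup y i FinP.≟ a
  ... | yes yᵢ≡a = ⊥-elim (yᵢ≢a yᵢ≡a)
  ... | no  _    = refl

  sumDiff-scale : ∀ i a c (g : Word k n → ℚ) → sumDiff i a (c · g) ≡ c * sumDiff i a g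
  sumDiff-scale i a c g =
    trans (sumOver-cong (allWords k n) (restrict≢-scale i a c g)) (sumW-scale c (restrict≢ i a g))

  sumDiff-pos : ∀ i a {g : Word k n → ℚ} → (∀ x → 0ℚ ≤ g x) →
                ∀ {y} → lookup y i ≢ a → 0ℚ < g y → 0ℚ < sumDiff i a g
  sumDiff-pos i a {g} g≥0 {y} yᵢ≢a 0<gy =
    <-≤-trans (subst (0ℚ <_) (sym (restrict≢-≢ i a g yᵢ≢a)) 0<gy)
              (≤-sumW (restrict≢-nonNeg i a g≥0) y)

  θ-scale : ∀ i a {c} (g : Word k n → ℚ) → c ≢ 0ℚ →
            sumW (c · g) * recip (sumDiff i a (c · g)) ≡ sumW g * recip (sumDiff i a g)
  θ-scale i a {c} g c≢0 = begin
    sumW (c · g) * recip (sumDiff i a (c · g))  ≡⟨ cong₂ (λ s d → s * recip d)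
                                                          (sumW-scale c g) (sumDiff-scale i a c g) ⟩
    c * S * recip (c * D)                       ≡⟨ cong (c * S *_) (recip-* c D) ⟩
    c * S * (recip c * recip D)                 ≡⟨ interchange c S (recip c) (recip D) ⟩
    c * recip c * (S * recip D)                 ≡⟨ cong (_* (S * recip D)) (*-recip c≢0) ⟩
    1ℚ * (S * recip D)                          ≡⟨ *-identityˡ (S * recip D) ⟩
    S * recip D                                 ∎
    where
    open ≡-Reasoning
    S = sumW g
    D = sumDiff i a g

record Reindexing {I J : Set} (P : I → Set) (g : I → ℚ) (Q : J → Set) (h : J → ℚ) : Set where
  field
    φ         : I → J
    feasible  : ∀ {z} → P z → Q (φ z)
    onto      : ∀ {w} → Q w → Σ I λ z → P z × φ z ≡ w
    preserves : ∀ {z} → P z → g z ≡ h (φ z)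

module _ {I J : Set} {P : I → Set} {g : I → ℚ} {Q : J → Set} {h : J → ℚ}
         (R : Reindexing P g Q h) where

  open Reindexing R

  IsMinOf-reindex⁺ : ∀ {t} → IsMinOf P g t → IsMinOf Q h t
  IsMinOf-reindex⁺ {t} ((z , Pz , gz≡t) , t≤g) =
    (φ z , feasible Pz , trans (sym (preserves Pz)) gz≡t) , t≤h
    where
    t≤h : ∀ w → Q w → t ≤ h w
    t≤h w Qw with onto Qw
    ... | z′ , Pz′ , refl = subst (t ≤_) (preserves Pz′) (t≤g z′ Pz′)

  IsMinOf-reindex⁻ : ∀ {t} → IsMinOf Q h t → IsMinOf P g t
  IsMinOf-reindex⁻ {t} ((w , Qw , hw≡t) , t≤h) with onto Qw
  ... | z , Pz , refl = (z , Pz , trans (preserves Pz) hw≡t) ,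
                        λ z′ Pz′ → subst (t ≤_) (sym (preserves Pz′)) (t≤h (φ z′) (feasible Pz′))

module _ {k m n : ℕ} (f : Word k n → Maybe (Fin m)) where

  InPart⇒InS : ∀ {A b x} → InPart f A b x → InS f x
  InPart⇒InS (_ , fx≡h , _) = ≡just⇒Is-just fx≡h

  parts-disjoint : ∀ {A x y} → InPart f A true x → InPart f A false y → f x ≢ f y
  parts-disjoint (h , fx≡h , Ah≡true) (h′ , fy≡h′ , Ah′≡false) fx≡fy
    with just-injective (trans (sym fx≡h) (trans fx≡fy fy≡h′))
  ... | refl with trans (sym Ah≡true) Ah′≡false
  ...   | ()

  normalize-isDist : ∀ {Z} {g : Word k n → ℚ} → (∀ x → 0ℚ ≤ g x) → 0ℚ < sumW g →
                     (∀ x → 0ℚ < g x → Z x) → IsDistOn f Z (normalize g)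
  normalize-isDist {g = g} g≥0 0<Σg g-supp =
      (λ x → nonNeg*nonNeg≥0 (<⇒≤ (recip-pos 0<Σg)) (g≥0 x))
    , (λ x 0<cgx → g-supp x (*-pos⇒posʳ {recip (sumW g)} (g≥0 x) 0<cgx))
    , trans (sumW-scale (recip (sumW g)) g) (trans (*-comm (recip (sumW g)) (sumW g)) (*-recip (0<⇒≢0 0<Σg)))

  Admissible₁⇒sums-pos : ∀ {u v} → Admissible₁ f u v → 0ℚ < sumW u × 0ℚ < sumW v
  Admissible₁⇒sums-pos {u} {v} (u≥0 , v≥0 , _ , _ , _ , x₀ , y₀ , ux₀*vy₀≢0) =
    <-≤-trans 0<ux₀ (≤-sumW u≥0 x₀) , <-≤-trans 0<vy₀ (≤-sumW v≥0 y₀)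
    where
    0<ux₀*vy₀ = 0≤∧≢0⇒0< (nonNeg*nonNeg≥0 (u≥0 x₀) (v≥0 y₀)) ux₀*vy₀≢0
    0<ux₀ = *-pos⇒posˡ {q = v y₀} (u≥0 x₀) 0<ux₀*vy₀
    0<vy₀ = *-pos⇒posʳ {u x₀} (v≥0 y₀) 0<ux₀*vy₀

  scaling-reindexing : ∀ {u v c d} → (∀ x → 0ℚ ≤ u x) → (∀ y → 0ℚ ≤ v y) → 0ℚ < c → 0ℚ < d →
    Reindexing (ActiveTriple₁ f u v) (objective₁ f u v)
               (ActiveTriple₁ f (c · u) (d · v)) (objective₁ f (c · u) (d · v))
  scaling-reindexing {u} {v} {c} {d} u≥0 v≥0 0<c 0<d = record
    { φ         = id
    ; feasible  = λ { {x , y , i} (0<uv , xᵢ≢yᵢ) →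
                      subst (0ℚ <_) (sym (interchange c (u x) d (v y))) (pos*pos>0 0<cd 0<uv) , xᵢ≢yᵢ }
    ; onto      = λ { {x , y , i} (0<cu*dv , xᵢ≢yᵢ) →
                      (x , y , i) , (unscale x y 0<cu*dv , xᵢ≢yᵢ) , refl }
    ; preserves = λ { {x , y , i} _ →
                      sym (cong₂ _⊔_ (θ-scale i (lookup x i) v (0<⇒≢0 0<d))
                                     (θ-scale i (lookup y i) u (0<⇒≢0 0<c))) }
    }
    where
    0<cd = pos*pos>0 0<c 0<d
    unscale : ∀ x y → 0ℚ < c * u x * (d * v y) → 0ℚ < u x * v y
    unscale x y 0<cu*dv = *-pos⇒posʳ {c * d} (nonNeg*nonNeg≥0 (u≥0 x) (v≥0 y))
                                     (subst (0ℚ <_) (interchange c (u x) d (v y)) 0<cu*dv)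

  Value₁-normalize : ∀ {u v t} → Admissible₁ f u v → Value₁ f u v t →
                     Value₁ f (normalize u) (normalize v) t
  Value₁-normalize adm@(u≥0 , v≥0 , _) with Admissible₁⇒sums-pos adm
  ... | 0<Σu , 0<Σv = IsMinOf-reindex⁺ (scaling-reindexing u≥0 v≥0 (recip-pos 0<Σu) (recip-pos 0<Σv))

  imageOfSupport? : (u : Word k n → ℚ) (h : Fin m) →
                    Dec (Any.Any (λ x → 0ℚ < u x × f x ≡ just h) (allWords k n))
  imageOfSupport? u h = Any.any? (λ x → (0ℚ <? u x) ×-dec ≡-dec FinP._≟_ (f x) (just h)) (allWords k n)

  imageOfSupport : (Word k n → ℚ) → Fin m → Bool
  imageOfSupport u h = does (imageOfSupport? u h)

  imageOfSupport-true : ∀ {u x h} → 0ℚ < u x → f x ≡ just h → imageOfSupport u h ≡ true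
  imageOfSupport-true {u} {x} {h} 0<ux fx≡h with imageOfSupport? u h
  ... | yes _   = refl
  ... | no  ¬∃x = ⊥-elim (¬∃x (lose (∈-allWords k n x) (0<ux , fx≡h)))

  imageOfSupport-false : ∀ {u v : Word k n → ℚ} {y h} →
                         (∀ x y → InS f x → InS f y → f x ≡ f y → u x * v y ≡ 0ℚ) → 0ℚ < v y → f y ≡ just h → imageOfSupport u h ≡ false
  imageOfSupport-false {u} {v} {y} {h} u*v≡0 0<vy fy≡h with imageOfSupport? u h
  ... | no  _  = refl
  ... | yes ∃x with Any.satisfied ∃x
  ...   | x , 0<ux , fx≡h =
    ⊥-elim (0<⇒≢0 (pos*pos>0 0<ux 0<vy)
                  (u*v≡0 x y (≡just⇒Is-just fx≡h) (≡just⇒Is-just fy≡h) (trans fx≡h (sym fy≡h))))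

  Admissible₁⇒Admissible₂ : ∀ {u v} → Admissible₁ f u v →
                            Admissible₂ f (imageOfSupport u) (normalize u) (normalize v)
  Admissible₁⇒Admissible₂ {u} {v} adm@(u≥0 , v≥0 , u-supp , v-supp , u*v≡0 , _)
    with Admissible₁⇒sums-pos adm
  ... | 0<Σu , 0<Σv = normalize-isDist u≥0 0<Σu supp-u , normalize-isDist v≥0 0<Σv supp-v
    where
    supp-u : ∀ x → 0ℚ < u x → InPart f (imageOfSupport u) true x
    supp-u x 0<ux with Is-just⇒≡just (u-supp x 0<ux)
    ... | h , fx≡h = h , fx≡h , imageOfSupport-true {u} 0<ux fx≡h
    supp-v : ∀ y → 0ℚ < v y → InPart f (imageOfSupport u) false y
    supp-v y 0<vy with Is-just⇒≡just (v-supp y 0<vy)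
    ... | h , fy≡h = h , fy≡h , imageOfSupport-false {u} {v} u*v≡0 0<vy fy≡h

  Admissible₂⇒Admissible₁ : ∀ {A p q} → Admissible₂ f A p q → Admissible₁ f p q
  Admissible₂⇒Admissible₁ {A} {p} {q} ((p≥0 , p-supp , Σp≡1) , (q≥0 , q-supp , Σq≡1))
    with sumW-pos⇒∃pos p (subst (0ℚ <_) (sym Σp≡1) (positive⁻¹ 1ℚ))
       | sumW-pos⇒∃pos q (subst (0ℚ <_) (sym Σq≡1) (positive⁻¹ 1ℚ))
  ... | x₀ , 0<px₀ | y₀ , 0<qy₀ =
      p≥0 , q≥0
    , (λ x 0<px → InPart⇒InS (p-supp x 0<px))
    , (λ y 0<qy → InPart⇒InS (q-supp y 0<qy))
    , (λ x y _ _ fx≡fy → *-nonNeg-≡0 (p≥0 x) (q≥0 y) λ (0<px , 0<qy) →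
                           parts-disjoint (p-supp x 0<px) (q-supp y 0<qy) fx≡fy)
    , x₀ , y₀ , 0<⇒≢0 (pos*pos>0 0<px₀ 0<qy₀)

  objective₁≡objective₂ : ∀ {p q x y i} → (∀ x → 0ℚ ≤ p x) → (∀ y → 0ℚ ≤ q y) →
    sumW p ≡ 1ℚ → sumW q ≡ 1ℚ → 0ℚ < p x → 0ℚ < q y → lookup x i ≢ lookup y i →
    objective₁ f p q (x , y , i) ≡ objective₂ f p q (i , lookup x i , lookup y i)
  objective₁≡objective₂ {p} {q} {x} {y} {i} p≥0 q≥0 Σp≡1 Σq≡1 0<px 0<qy xᵢ≢yᵢ = begin
    sumW q * recip a ⊔ sumW p * recip b  ≡⟨ cong₂ (λ s s′ → s * recip a ⊔ s′ * recip b) Σq≡1 Σp≡1 ⟩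
    1ℚ * recip a ⊔ 1ℚ * recip b          ≡⟨ cong₂ _⊔_ (*-identityˡ (recip a)) (*-identityˡ (recip b)) ⟩
    recip a ⊔ recip b                    ≡⟨ recip-⊓ 0<a 0<b ⟨
    recip (a ⊓ b)                        ∎
    where
    open ≡-Reasoning
    a = sumDiff i (lookup x i) q
    b = sumDiff i (lookup y i) p
    0<a = sumDiff-pos i (lookup x i) q≥0 (≢-sym xᵢ≢yᵢ) 0<qy
    0<b = sumDiff-pos i (lookup y i) p≥0 xᵢ≢yᵢ 0<px

  active-reindexing : ∀ {A p q} → Admissible₂ f A p q →
    Reindexing (ActiveTriple₁ f p q) (objective₁ f p q) (ActiveIndex₂ f A p q) (objective₂ f p q)
  active-reindexing {A} {p} {q} ((p≥0 , p-supp , Σp≡1) , (q≥0 , q-supp , Σq≡1)) = record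
    { φ         = λ (x , y , i) → i , lookup x i , lookup y i
    ; feasible  = λ { {x , y , i} (0<pq , xᵢ≢yᵢ) →
                      xᵢ≢yᵢ , x , y , p-supp x (0<px 0<pq) , q-supp y (0<qy 0<pq) , refl , refl , 0<pq }
    ; onto      = λ { {i , _ , _} (g₁≢g₂ , x , y , _ , _ , refl , refl , 0<pq) →
                      (x , y , i) , (0<pq , g₁≢g₂) , refl }
    ; preserves = λ { {x , y , i} (0<pq , xᵢ≢yᵢ) →
                      objective₁≡objective₂ p≥0 q≥0 Σp≡1 Σq≡1 (0<px 0<pq) (0<qy 0<pq) xᵢ≢yᵢ }
    }
    where
    0<px : ∀ {x y} → 0ℚ < p x * q y → 0ℚ < p x
    0<px {x} {y} = *-pos⇒posˡ {q = q y} (p≥0 x)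
    0<qy : ∀ {x y} → 0ℚ < p x * q y → 0ℚ < q y
    0<qy {x} {y} = *-pos⇒posʳ {p x} (q≥0 y)

proposition1 : (k m n : ℕ) (f : Word k n → Maybe (Fin m)) → NonConstant f →
    ((u v : Word k n → ℚ) → Admissible₁ f u v → (t : ℚ) → Value₁ f u v t →
       Σ (Fin m → Bool) λ A → Σ (Word k n → ℚ) λ p → Σ (Word k n → ℚ) λ q →
       Σ ℚ λ s → Admissible₂ f A p q × Value₂ f A p q s × t ≤ s)
    ×
    ((A : Fin m → Bool) (p q : Word k n → ℚ) → Admissible₂ f A p q → (s : ℚ) → Value₂ f A p q s →
       Σ (Word k n → ℚ) λ u → Σ (Word k n → ℚ) λ v →
       Σ ℚ λ t → Admissible₁ f u v × Value₁ f u v t × s ≤ t)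
-- Non-constancy only guarantees that admissible pairs exist on both sides;
-- the correspondence between them does not need it.
proposition1 k m n f _ =
    (λ u v adm t val →
       let adm₂ = Admissible₁⇒Admissible₂ f adm in
       imageOfSupport f u , normalize u , normalize v , t , adm₂ ,
       IsMinOf-reindex⁺ (active-reindexing f adm₂) (Value₁-normalize f adm val) , ≤-refl)
  , (λ A p q adm s val →
       p , q , s , Admissible₂⇒Admissible₁ f adm ,
       IsMinOf-reindex⁻ (active-reindexing f adm) val , ≤-refl)
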